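{- Let $G$ be a finite simple graph, $X\subseteq V(G)$, $S\subset V(G)$ a separator of $G$, and $F$ an $S$-fragment of $G$ with $F\cap X=\emptyset$. Let $G'$ be the graph obtained from $G[\overline{F}\cup S]$ by adding all possible edges between vertices of $S$ (if not already present), where $\overline{F}=V(G-S)\setminus F$. Then $\kappa_{G'}(X)\ge\kappa_G(X)$.
   Context: A set $S\subset V(G)$ is an $X$-separator of $G$ if at least two components of $G-S$ contain a vertex of $X$; a separator is a $V(G)$-separator. For a separator $S$, an $S$-fragment is the union $F$ of the vertex sets of at least one but not all components of $G-S$ (then $\overline{F}=V(G-S)\setminus F$ is nonempty). $\kappa_G(X)$ denotes the maximum integer less than or equal to $|X|-1$ such that every $X$-separator of $G$ (if any exists) has cardinality at least $\kappa_G(X)$. -}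

module Defs where

open import Level using (0ℓ)
open import Data.Nat using (ℕ)
open import Data.Integer using (ℤ; +_; _-_; _≤_; 1ℤ)
open import Data.Fin using (Fin)
open import Data.Fin.Subset using (Subset; _∈_; _∉_; _⊆_; ∣_∣; ∁; ⊤)
open import Data.Product using (Σ; ∃; _×_)
open import Data.Sum using (_⊎_)
open import Relation.Nullary using (¬_)
open import Relation.Binary.PropositionalEquality using (_≡_; _≢_)

record SimpleGraph (n : ℕ) : Set₁ where
  field
    Adj    : Fin n → Fin n → Set
    sym    : ∀ {u v} → Adj u v → Adj v u
    irrefl : ∀ {u} → ¬ Adj u u
open SimpleGraph public

-- A graph "presented" by a vertex set U ⊆ Fin n and an adjacency relation on Fin n
-- (only edges between vertices of U matter).  This lets us speak of induced subgraphs.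
Rel : ℕ → Set₁
Rel n = Fin n → Fin n → Set

data Walk {n : ℕ} (U : Subset n) (A : Rel n) (S : Subset n) : Fin n → Fin n → Set where
  here : ∀ {u} → u ∈ U → u ∉ S → Walk U A S u u
  step : ∀ {u w v} → u ∈ U → u ∉ S → A u w → Walk U A S w v → Walk U A S u v

IsXSeparator : ∀ {n} → Subset n → Rel n → Subset n → Subset n → Set
IsXSeparator U A X S =
  S ⊆ U × ∃ λ x → ∃ λ y →
    x ∈ X × y ∈ X × x ∈ U × x ∉ S × y ∈ U × y ∉ S × ¬ Walk U A S x y

KappaBound : ∀ {n} → Subset n → Rel n → Subset n → ℤ → Set
KappaBound U A X k =
  (k ≤ (+ ∣ X ∣) - 1ℤ) × (∀ S → IsXSeparator U A X S → k ≤ + ∣ S ∣)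

IsKappa : ∀ {n} → Subset n → Rel n → Subset n → ℤ → Set
IsKappa U A X k = KappaBound U A X k × (∀ j → KappaBound U A X j → j ≤ k)

IsSeparator : ∀ {n} → SimpleGraph n → Subset n → Set
IsSeparator {n} G S = IsXSeparator ⊤ (Adj G) ⊤ S

-- F is an S-fragment of G: the union of the vertex sets of at least one but not all
-- components of G − S, i.e. F ⊆ V(G) ∖ S, F is a union of components (closed under
-- walks in G − S), F ≠ ∅, and some vertex of G − S is not in F.
IsFragment : ∀ {n} → SimpleGraph n → Subset n → Subset n → Set
IsFragment G S F =
  (∀ {u} → u ∈ F → u ∉ S)
  × (∀ {u v} → u ∈ F → Walk ⊤ (Adj G) S u v → v ∈ F)
  × (∃ λ u → u ∈ F)
  × (∃ λ u → u ∉ S × u ∉ F)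

-- G' : from G[F̄ ∪ S] add all edges between distinct vertices of S.
-- Since V(G) = F ∪ F̄ ∪ S disjointly, F̄ ∪ S = V(G) ∖ F = ∁ F.
G'Vertices : ∀ {n} → Subset n → Subset n
G'Vertices F = ∁ F

G'Adj : ∀ {n} → SimpleGraph n → Subset n → Rel n
G'Adj G S u v = Adj G u v ⊎ (u ∈ S × v ∈ S × u ≢ v)

module Submission where

-- Idea of the proof.  κ is the largest admissible lower bound on the sizes of
-- X-separators, so it suffices to show that κ_G(X) is also an admissible bound
-- for G'; as |X| is the same in both graphs, this reduces to showing that every
-- X-separator T of G' is an X-separator of G.  Equivalently: any walk of G − T
-- between two vertices outside F can be turned into a walk of G' − T with the
-- same ends.  The walk uses only vertices of V(G) ∖ F = V(G') except for
-- excursions into F.  Since F is a union of components of G − S, a neighbour of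
-- a vertex of F lies in F or in S (`boundary`), so every excursion is entered
-- from a vertex s ∈ S and left to a vertex s' ∈ S; in G' these are equal or
-- adjacent through the clique added on S (`cliqueShortcut`), so the excursion
-- can be cut out.

open import Defs
open import Data.Integer using (ℤ; _≤_)
open import Data.Fin using (Fin; _≟_)
open import Data.Fin.Subset using (Subset; _∈_; _∉_; ⊤; ∁)
open import Data.Fin.Subset.Properties using (x∈∁p⇒x∉p; x∉p⇒x∈∁p; ∈⊤; _∈?_)
open import Data.Product using (_,_; proj₁; proj₂)
open import Data.Sum using (inj₁; inj₂)
open import Relation.Nullary using (yes; no)
open import Relation.Nullary.Negation using (contradiction)
open import Relation.Binary.PropositionalEquality using (refl)

module FragmentWalks {n} (G : SimpleGraph n) (S F T : Subset n)
                     (frag : IsFragment G S F) where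

  disjoint : ∀ {u} → u ∈ F → u ∉ S
  disjoint = proj₁ frag

  closed : ∀ {u v} → u ∈ F → Walk ⊤ (Adj G) S u v → v ∈ F
  closed = proj₁ (proj₂ frag)

  boundary : ∀ {u v} → u ∈ F → Adj G u v → v ∉ F → v ∈ S
  boundary {v = v} uF uv vF with v ∈? S
  ... | yes vS = vS
  ... | no  vS = contradiction (closed uF (step ∈⊤ (disjoint uF) uv (here ∈⊤ vS))) vF

  G'Walk : Fin n → Fin n → Set
  G'Walk = Walk (∁ F) (G'Adj G S) T

  -- Two vertices of S outside F and T are equal or adjacent in G', so a G'-walk
  -- from one of them may be started at the other instead.
  cliqueShortcut : ∀ {s s' v} → s ∈ S → s' ∈ S → s ∉ F → s ∉ T →
                   G'Walk s' v → G'Walk s v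
  cliqueShortcut {s} {s'} sS s'S sF sT W with s ≟ s'
  ... | yes refl = W
  ... | no  s≢s' = step (x∉p⇒x∈∁p sF) sT (inj₂ (sS , s'S , s≢s')) W

  mutual
    toG'Walk : ∀ {u v} → Walk ⊤ (Adj G) T u v → u ∉ F → v ∉ F → G'Walk u v
    toG'Walk (here _ uT) uF vF = here (x∉p⇒x∈∁p uF) uT
    toG'Walk (step {w = w} _ uT uw W) uF vF with w ∈? F
    ... | no  wF = step (x∉p⇒x∈∁p uF) uT (inj₁ uw) (toG'Walk W wF vF)
    ... | yes wF = skipExcursion (boundary wF (sym G uw) uF) uT uF W wF vF

    -- The walk has entered F from s ∈ S; follow it inside F until it leaves
    -- through some s' ∈ S, and jump from s to s' along the clique on S.
    skipExcursion : ∀ {s w v} → s ∈ S → s ∉ T → s ∉ F →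
                    Walk ⊤ (Adj G) T w v → w ∈ F → v ∉ F → G'Walk s v
    skipExcursion sS sT sF (here _ _) wF vF = contradiction wF vF
    skipExcursion sS sT sF (step {w = w'} _ _ ww' W) wF vF with w' ∈? F
    ... | yes w'F = skipExcursion sS sT sF W w'F vF
    ... | no  w'F = cliqueShortcut sS (boundary wF ww' w'F) sF sT
                                   (toG'Walk W w'F vF)

separatorOfG' : ∀ {n} (G : SimpleGraph n) (X S F T : Subset n) →
                IsFragment G S F →
                IsXSeparator (G'Vertices F) (G'Adj G S) X T → IsXSeparator ⊤ (Adj G) X T
separatorOfG' G X S F T frag (_ , x , y , xX , yX , xU , xT , yU , yT , noWalk) =
  (λ _ → ∈⊤) , x , y , xX , yX , ∈⊤ , xT , ∈⊤ , yT ,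
  λ W → noWalk (toG'Walk W (x∈∁p⇒x∉p xU) (x∈∁p⇒x∉p yU))
  where open FragmentWalks G S F T frag

kappaBoundTransfer : ∀ {n} {U U' : Subset n} {A A' : Rel n} (X : Subset n) (k : ℤ) →
                     (∀ T → IsXSeparator U' A' X T → IsXSeparator U A X T) →
                     KappaBound U A X k → KappaBound U' A' X k
kappaBoundTransfer X k sepTransfer (k≤|X|-1 , bound) =
  k≤|X|-1 , λ T sepT → bound T (sepTransfer T sepT)

-- κ_G(X) is an admissible bound for G', hence at most the maximal one, κ_{G'}(X).
lemma3 : ∀ {n} (G : SimpleGraph n) (X S F : Subset n) →
    IsSeparator G S → IsFragment G S F → (∀ {v} → v ∈ F → v ∉ X) →
    ∀ (k k' : ℤ) → IsKappa ⊤ (Adj G) X k → IsKappa (G'Vertices F) (G'Adj G S) X k' →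
    k ≤ k'
lemma3 G X S F _ frag _ k k' (kBound , _) (_ , k'Maximal) =
  k'Maximal k (kappaBoundTransfer X k (λ T → separatorOfG' G X S F T frag) kBound)
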